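{- Let $\mathsf{C}$ be a context-machine and $M,N\in\mathcal{M}$. The following are equivalent: (1) $\mathsf{C}\langle M\rangle\twoheadrightarrow_h N$; (2) there is an extended machine $\mathsf{C}'$ (with finitely many occurrences of $\xi$) such that $\mathsf{C}\twoheadrightarrow_h^{M}\mathsf{C}'$ and $\mathsf{C}'\langle M\rangle=N$.
   Context: Addressing machines. Fix a countable set $\mathbb{A}$ of addresses and a symbol $\varnothing\notin\mathbb{A}$; $\mathbb{A}_\varnothing=\mathbb{A}\cup\{\varnothing\}$. A tape is a finite list of addresses; $a::T$ has head $a$ and tail $T$, $T@T'$ is concatenation. A program is a finite list of instructions generated by $P::=\mathtt{Load}\ i;P\mid A$, $A::=\mathtt{App}(i,j,k);A\mid C$, $C::=\mathtt{Call}\ i\mid\varepsilon$ ($i,j,k\in\mathbb{N}$). For $r\in\mathbb{N}$, $I\subseteq\{0,\dots,r-1\}$, $I\models^r P$ is the least relation such that: $I\models^r\varepsilon$; $I\models^r\mathtt{Call}\ i$ if $i\in I$; $I\models^r\mathtt{App}(i,j,k);A$ if $i,j\in I$ and either ($k<r$ and $I\cup\{k\}\models^r A$) or ($k\ge r$ and $I\models^r A$); $I\models^r\mathtt{Load}\ i;P$ if either ($i<r$ and $I\cup\{i\}\models^r P$) or ($i\ge r$ and $I\models^r P$). An addressing machine is $M=\langle R_0,\dots,R_{r-1},P,T\rangle$ with registers in $\mathbb{A}_\varnothing$, $P$ valid w.r.t. the registers ($\{i<r\mid R_i\ne\varnothing\}\models^r P$), and an $\mathbb{A}$-valued tape $T$;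 $\mathcal{M}$ is the set of all of them. $\vec R[R_i:=a]$ replaces $R_i$ by $a$ if $i<r$, is $\vec R$ if $i\ge r$. Fix a bijection $\#:\mathcal{M}\to\mathbb{A}$. Extended machines. Let $\xi=\langle[]\rangle$ be a new object (the hole). Fix a countable set $\mathbb{B}$ with $\mathbb{A}\cap\mathbb{B}=\emptyset$, put $\mathbb{X}=\mathbb{A}\cup\mathbb{B}$ and $\mathbb{X}_\varnothing=\mathbb{X}\cup\{\varnothing\}$. An extended machine is either $\xi@T$ with $T$ an $\mathbb{X}$-valued tape, or $\langle\vec R,P,T\rangle$ with $\mathbb{X}_\varnothing$-valued registers, a program valid w.r.t. them, and an $\mathbb{X}$-valued tape; the set of extended machines contains $\mathcal{M}$. Fix a bijection $\underline{\#}$ from extended machines to $\mathbb{X}$ with $\underline{\#}(M)=\#M$ for $M\in\mathcal{M}$, inverse $\underline{\#}^{ -1}$. For an extended machine $X$ and $\mathbb{X}$-tape $T'$: $(\xi@T)@T'=\xi@(T@T')$ and $\langle\vec R,P,T\rangle@T'=\langle\vec R,P,T@T'\rangle$; $a\cdot b=\underline{\#}(\underline{\#}^{ -1}(a)@[b])$. The number $\mathrm{occ}_\xi(X)\in\mathbb{N}\cup\{\infty\}$ of occurrences of $\xi$ counts (with multiplicity) the occurrences of $\xi$ reached by recursively dereferencing, via $\underline{\#}^{ -1}$, all addresses in registers and tape: $\mathrm{occ}_\xi(\xi@T)=1+\mathrm{occ}_\xi(T)$, $\mathrm{occ}_\xi(\langle\vec R,P,T\rangle)=\mathrm{occ}_\xi(T)+\sum_i\mathrm{occ}_\xi(R_i)$,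 $\mathrm{occ}_\xi([a_1,\dots,a_n])=\sum_j\mathrm{occ}_\xi(\underline{\#}^{ -1}(a_j))$, $\mathrm{occ}_\xi(\varnothing)=0$, $\mathrm{occ}_\xi(a)=\mathrm{occ}_\xi(\underline{\#}^{ -1}(a))$. A context-machine is an extended machine $\mathsf{C}$ with $\mathrm{occ}_\xi(\mathsf{C})\in\mathbb{N}$. For such $\mathsf{C}$ and $M\in\mathcal{M}$, the machine $\mathsf{C}\langle M\rangle\in\mathcal{M}$ is: $(\xi@T)\langle M\rangle=M@(T\langle M\rangle)$, $\langle\vec R,P,T\rangle\langle M\rangle=\langle\vec R\langle M\rangle,P,T\langle M\rangle\rangle$, where $a\langle M\rangle=\underline{\#}(\underline{\#}^{ -1}(a)\langle M\rangle)$, $\varnothing\langle M\rangle=\varnothing$, and tapes/registers are treated componentwise. Head reduction $\to_h$ on extended machines: $\langle\vec R,\mathtt{Load}\ i;P,a::T\rangle\to_h\langle\vec R[R_i:=a],P,T\rangle$, $\langle\vec R,\mathtt{App}(i,j,k);P,T\rangle\to_h\langle\vec R[R_k:=R_i\cdot R_j],P,T\rangle$, $\langle\vec R,\mathtt{Call}\ i,T\rangle\to_h\underline{\#}^{ -1}(R_i)@T$; machines $\xi@T$ have no reduct. Given $M\in\mathcal{M}$, the $M$-underlined reduction $\to_h^M$ consists of these rules plus $\xi@T\to_h^M M@T$; $\twoheadrightarrow_h$, $\twoheadrightarrow_h^M$ are reflexive-transitive closures. -}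

module Defs where

open import Data.Nat using (ℕ; zero; suc)
open import Data.Fin using (Fin)
open import Data.Bool using (Bool; true; false; _∧_; T)
open import Data.Maybe using (Maybe; just; nothing; is-just)
import Data.Maybe as Maybe
open import Data.Vec using (Vec; []; _∷_)
import Data.Vec as Vec
open import Data.List using (List; []; _∷_; _++_; length)
import Data.List as List
open import Data.Sum using (_⊎_; inj₁; inj₂)
open import Data.Product using (Σ; _,_; _×_)
open import Function.Bundles using (_↔_; Inverse)
open import Relation.Binary.PropositionalEquality using (_≡_; refl; cong; sym; subst)

data CProg : Set where
  call : ℕ → CProg
  ε    : CProg

data AProg : Set where
  app   : ℕ → ℕ → ℕ → AProg → AProg
  cprog : CProg → AProg

data Prog : Set where
  load  : ℕ → Prog → Prog
  aprog : AProg → Prog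

-- Subsets I ⊆ {0,…,r-1} as characteristic vectors (Vec Bool r).

-- i ∈ I  (false when i ≥ r)
memℕ : ∀ {r} → Vec Bool r → ℕ → Bool
memℕ []       _       = false
memℕ (b ∷ bs) zero    = b
memℕ (b ∷ bs) (suc i) = memℕ bs i

-- I ∪ {k} if k < r, and I if k ≥ r
addℕ : ∀ {r} → Vec Bool r → ℕ → Vec Bool r
addℕ []       _       = []
addℕ (b ∷ bs) zero    = true ∷ bs
addℕ (b ∷ bs) (suc k) = b ∷ addℕ bs k

-- The validity relation I ⊨^r P, as a (decidable) boolean following
-- exactly the defining clauses of the least relation.
validC : ∀ {r} → Vec Bool r → CProg → Bool
validC I (call i) = memℕ I i
validC I ε        = true

validA : ∀ {r} → Vec Bool r → AProg → Bool
validA I (app i j k A) = memℕ I i ∧ (memℕ I j ∧ validA (addℕ I k) A)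
validA I (cprog c)     = validC I c

validP : ∀ {r} → Vec Bool r → Prog → Bool
validP I (load i P) = validP (addℕ I i) P
validP I (aprog A)  = validA I A

-- Machines over an address type (registers Maybe-valued; nothing = ∅)

regSet : ∀ {A : Set} {r} → Vec (Maybe A) r → Vec Bool r
regSet = Vec.map is-just

record Raw (A : Set) : Set where
  constructor mk
  field
    r    : ℕ
    regs : Vec (Maybe A) r
    prog : Prog
    tape : List A

Mach : Set → Set
Mach A = Σ (Raw A) λ m → T (validP (regSet (Raw.regs m)) (Raw.prog m))

-- extended machines over the address set X: ξ@T or ⟨R,P,T⟩
data Ext (X : Set) : Set where
  hole : List X → Ext X
  ext  : Mach X → Ext X

appendM : ∀ {A} → Mach A → List A → Mach A
appendM (mk r R P T , v) T' = mk r R P (T ++ T') , v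

appendE : ∀ {X} → Ext X → List X → Ext X
appendE (hole T) T' = hole (T ++ T')
appendE (ext m)  T' = ext (appendM m T')

regSet-map : ∀ {A B : Set} {r} (f : A → B) (R : Vec (Maybe A) r) →
             regSet (Vec.map (Maybe.map f) R) ≡ regSet R
regSet-map f []             = refl
regSet-map f (nothing ∷ R)  = cong (false ∷_) (regSet-map f R)
regSet-map f (just x ∷ R)   = cong (true ∷_) (regSet-map f R)

-- the inclusion 𝓜 ⊆ extended machines (addresses of 𝔸 seen in 𝔸 ⊎ 𝔹)
embed : ∀ {A B : Set} → Mach A → Mach (A ⊎ B)
embed {A} {B} (mk r R P tp , v) =
  mk r (Vec.map (Maybe.map inj₁) R) P (List.map inj₁ tp) ,
  subst (λ I → T (validP I P)) (sym (regSet-map {B = A ⊎ B} inj₁ R)) v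

-- The fixed data: countable 𝔸, 𝔹 (disjointness is built in via ⊎),
-- bijection # : 𝓜 → 𝔸 and its extension #̲ : extended machines → 𝕏.

record Setup : Set₁ where
  field
    𝔸 𝔹         : Set
    𝔸-countable : 𝔸 ↔ ℕ
    𝔹-countable : 𝔹 ↔ ℕ
    code        : Mach 𝔸 ↔ 𝔸
    codeₓ       : Ext (𝔸 ⊎ 𝔹) ↔ (𝔸 ⊎ 𝔹)
    codeₓ-ext   : ∀ (M : Mach 𝔸) → Inverse.to codeₓ (ext (embed M)) ≡ inj₁ (Inverse.to code M)

𝕏 : Setup → Set
𝕏 S = Setup.𝔸 S ⊎ Setup.𝔹 S

-- register lookup (∅ if out of range) and update R[R_i := a]
getReg : ∀ {A : Set} {r} → Vec (Maybe A) r → ℕ → Maybe A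
getReg []       _       = nothing
getReg (x ∷ xs) zero    = x
getReg (x ∷ xs) (suc i) = getReg xs i

setReg : ∀ {A : Set} {r} → Vec (Maybe A) r → ℕ → Maybe A → Vec (Maybe A) r
setReg []       _       a = []
setReg (x ∷ xs) zero    a = a ∷ xs
setReg (x ∷ xs) (suc i) a = x ∷ setReg xs i a

module _ (S : Setup) where
  open Setup S
  private
    X = 𝔸 ⊎ 𝔹

  deref : X → Ext X
  deref = Inverse.from codeₓ

  _·_ : X → X → X
  a · b = Inverse.to codeₓ (appendE (deref a) (b ∷ []))

  -- head reduction on extended machines
  -- (the reduct carries its validity proof; it is a proof of T b, hence unique)
  data _→h_ : Ext X → Ext X → Set where
    load : ∀ {r R i P a T v v'} →
           ext (mk r R (load i P) (a ∷ T) , v) →h ext (mk r (setReg R i (just a)) P T , v')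
    app  : ∀ {r R i j k A T v a b v'} → getReg R i ≡ just a → getReg R j ≡ just b →
           ext (mk r R (aprog (app i j k A)) T , v) →h
           ext (mk r (setReg R k (just (a · b))) (aprog A) T , v')
    call : ∀ {r R i T v a} → getReg R i ≡ just a →
           ext (mk r R (aprog (cprog (call i))) T , v) →h appendE (deref a) T

  data _→h[_]_ : Ext X → Mach 𝔸 → Ext X → Set where
    head : ∀ {C C' M} → C →h C' → C →h[ M ] C'
    fill : ∀ {T M} → hole T →h[ M ] appendE (ext (embed M)) T

  -- occurrences of ξ: each occurrence reached by dereferencing is
  -- identified by the (finite) path of positions leading to it.
  data Path : Ext X → Set
  data PathR : Maybe X → Set

  data Path where
    here   : ∀ {T} → Path (hole T)
    tape-h : ∀ {T} (j : Fin (length T)) → Path (deref (List.lookup T j)) → Path (hole T)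
    tape-m : ∀ {r R P T v} (j : Fin (length T)) → Path (deref (List.lookup T j)) →
             Path (ext (mk r R P T , v))
    reg-m  : ∀ {r R P T v} (i : Fin r) → PathR (Vec.lookup R i) →
             Path (ext (mk r R P T , v))

  data PathR where
    at : ∀ {a} → Path (deref a) → PathR (just a)

  Occ≡ : Ext X → ℕ → Set
  Occ≡ C n = Path C ↔ Fin n

  -- occ_ξ(C) ∈ ℕ, i.e. C is a context-machine
  OccFinite : Ext X → Set
  OccFinite C = Σ ℕ λ n → Occ≡ C n

  -- C⟨M⟩ = N, as the relation generated by the defining equations.
  -- Addresses of 𝔸 point to ordinary machines (no ξ) and are left unchanged.
  data SubstE (M : Mach 𝔸) : Ext X → Mach 𝔸 → Set
  data SubstA (M : Mach 𝔸) : X → 𝔸 → Set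
  data SubstT (M : Mach 𝔸) : List X → List 𝔸 → Set
  data SubstR (M : Mach 𝔸) : ∀ {r} → Vec (Maybe X) r → Vec (Maybe 𝔸) r → Set

  data SubstE M where
    hole : ∀ {T T'} → SubstT M T T' → SubstE M (hole T) (appendM M T')
    mach : ∀ {r R P T v R' T' v'} → SubstR M R R' → SubstT M T T' →
           SubstE M (ext (mk r R P T , v)) (mk r R' P T' , v')

  data SubstA M where
    inA : ∀ {a} → SubstA M (inj₁ a) a
    inB : ∀ {b N} → SubstE M (deref (inj₂ b)) N → SubstA M (inj₂ b) (Inverse.to code N)

  data SubstT M where
    []  : SubstT M [] []
    _∷_ : ∀ {a a' T T'} → SubstA M a a' → SubstT M T T' → SubstT M (a ∷ T) (a' ∷ T')

  data SubstR M where
    []   : SubstR M [] []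
    ∅∷_  : ∀ {r} {R : Vec (Maybe X) r} {R'} → SubstR M R R' → SubstR M (nothing ∷ R) (nothing ∷ R')
    _∷_  : ∀ {r a a'} {R : Vec (Maybe X) r} {R'} → SubstA M a a' → SubstR M R R' →
           SubstR M (just a ∷ R) (just a' ∷ R')

-- Filling commutes with head reduction. A head step of C fires in C⟨M⟩ as
-- the same instruction on the filled registers and tape (the filling of a · b
-- being the application of the fillings), while a hole step ξ @ T ↦ M @ T is
-- invisible after filling. Conversely C⟨M⟩ can only fire an instruction when
-- the machine underlying C (after filling a head hole) can, and head
-- reduction is deterministic, so every head step of C⟨M⟩ is the image of
-- underlined steps of C. Finiteness of occ_ξ comes for free: a derivation of
-- C'⟨M⟩ = N is a finite tree through which every occurrence of ξ is reached.
module Submission where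

open import Defs
open import Data.Nat using (ℕ; zero; suc; _+_)
open import Data.Fin using (Fin; zero; suc)
open import Data.Fin.Properties using (+↔⊎; 1↔⊤)
open import Data.Bool using (T)
open import Data.Bool.Properties using (T-irrelevant; T-∧)
open import Data.Maybe using (Maybe; just; nothing; is-just)
import Data.Maybe as Maybe
open import Data.Maybe.Properties using (just-injective) renaming (map-injective to Maybe-map-injective)
open import Data.Vec using (Vec; []; _∷_)
import Data.Vec as Vec
open import Data.Vec.Properties using (∷-injectiveˡ; ∷-injectiveʳ; lookup-map)
open import Data.List using (List; []; _∷_; _++_; length)
import Data.List as List
open import Data.List.Properties using (++-assoc; map-++) renaming (map-injective to List-map-injective)
open import Data.Sum using (_⊎_; inj₁; inj₂)
open import Data.Sum.Properties using (inj₁-injective)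
open import Data.Sum.Function.Propositional using (_⊎-cong_)
open import Data.Product using (Σ; ∃; _,_; _×_; proj₁; proj₂)
open import Data.Unit using (⊤; tt)
open import Data.Empty using (⊥; ⊥-elim)
open import Function using (_∘_)
open import Function.Bundles using (_↔_; Inverse; _⇔_; Equivalence; mk⇔; mk↔ₛ′)
open import Function.Definitions using (Injective)
open import Function.Properties.Inverse using (↔-trans; ↔-sym)
open import Relation.Nullary using (¬_)
open import Relation.Binary.PropositionalEquality
open import Relation.Binary.Construct.Closure.ReflexiveTransitive using (Star; ε; _◅_; _◅◅_)

Mach-≡ : ∀ {X} {m m' : Mach X} → proj₁ m ≡ proj₁ m' → m ≡ m'
Mach-≡ {m = m , v} {.m , v'} refl = cong (m ,_) (T-irrelevant v v')

ext-injective : ∀ {X} {m m' : Mach X} → ext m ≡ ext m' → m ≡ m'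
ext-injective refl = refl

mk-injective : ∀ {X r} {R R' : Vec (Maybe X) r} {P P' T T'} →
               mk r R P T ≡ mk r R' P' T' → R ≡ R' × P ≡ P' × T ≡ T'
mk-injective refl = refl , refl , refl

Vec-map-injective : ∀ {A B : Set} {f : A → B} {n} → Injective _≡_ _≡_ f →
                    Injective _≡_ _≡_ (Vec.map {n = n} f)
Vec-map-injective f-inj {[]}     {[]}     _ = refl
Vec-map-injective f-inj {x ∷ xs} {y ∷ ys} e =
  cong₂ _∷_ (f-inj (∷-injectiveˡ e)) (Vec-map-injective f-inj (∷-injectiveʳ e))

embed-injective : ∀ {A B : Set} {K N : Mach A} → ext (embed {B = B} K) ≡ ext (embed N) → K ≡ N
embed-injective {K = mk r R P T , _} {mk r' R' P' T' , _} e
  with cong proj₁ (ext-injective e)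
... | e' with cong Raw.r e'
... | refl with mk-injective e'
... | eR , refl , eT =
  Mach-≡ (cong₂ (λ R T → mk r R P T)
                (Vec-map-injective (Maybe-map-injective inj₁-injective) eR)
                (List-map-injective inj₁-injective eT))

appendM-++ : ∀ {X} (m : Mach X) T T' → appendM (appendM m T) T' ≡ appendM m (T ++ T')
appendM-++ (mk r R P T₀ , v) T T' = Mach-≡ (cong (mk r R P) (++-assoc T₀ T T'))

embed-appendM : ∀ {A B : Set} (m : Mach A) T →
                embed {B = B} (appendM m T) ≡ appendM (embed m) (List.map inj₁ T)
embed-appendM (mk r R P T₀ , v) T = Mach-≡ (cong (mk r _ P) (map-++ inj₁ T₀ T))

getReg-map : ∀ {A B : Set} {r} (f : A → B) (R : Vec (Maybe A) r) i →
             getReg (Vec.map (Maybe.map f) R) i ≡ Maybe.map f (getReg R i)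
getReg-map f []      i       = refl
getReg-map f (x ∷ R) zero    = refl
getReg-map f (x ∷ R) (suc i) = getReg-map f R i

setReg-map : ∀ {A B : Set} {r} (f : A → B) (R : Vec (Maybe A) r) i x →
             setReg (Vec.map (Maybe.map f) R) i (Maybe.map f x) ≡ Vec.map (Maybe.map f) (setReg R i x)
setReg-map f []      i       x = refl
setReg-map f (y ∷ R) zero    x = refl
setReg-map f (y ∷ R) (suc i) x = cong (_ ∷_) (setReg-map f R i x)

regSet-setReg : ∀ {A : Set} {r} (R : Vec (Maybe A) r) i a →
                regSet (setReg R i (just a)) ≡ addℕ (regSet R) i
regSet-setReg []      i       a = refl
regSet-setReg (x ∷ R) zero    a = refl
regSet-setReg (x ∷ R) (suc i) a = cong (is-just x ∷_) (regSet-setReg R i a)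

load-reduct-valid : ∀ {A : Set} {r} (R : Vec (Maybe A) r) i P a →
                    T (validP (regSet R) (load i P)) → T (validP (regSet (setReg R i (just a))) P)
load-reduct-valid R i P a = subst (λ I → T (validP I P)) (sym (regSet-setReg R i a))

app-reduct-valid : ∀ {A : Set} {r} (R : Vec (Maybe A) r) i j k Q c →
                   T (validP (regSet R) (aprog (app i j k Q))) →
                   T (validP (regSet (setReg R k (just c))) (aprog Q))
app-reduct-valid R i j k Q c v =
  subst (λ I → T (validA I Q)) (sym (regSet-setReg R k c))
        (proj₂ (Equivalence.to (T-∧ {memℕ (regSet R) j})
               (proj₂ (Equivalence.to (T-∧ {memℕ (regSet R) i}) v))))

Finite : Set → Set
Finite A = Σ ℕ λ n → A ↔ Fin n

Finite-↔ : ∀ {A B} → A ↔ B → Finite B → Finite A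
Finite-↔ f (n , g) = n , ↔-trans f g

Finite-⊎ : ∀ {A B} → Finite A → Finite B → Finite (A ⊎ B)
Finite-⊎ (m , f) (n , g) = m + n , ↔-trans (f ⊎-cong g) (↔-sym +↔⊎)

Finite-⊤ : Finite ⊤
Finite-⊤ = 1 , ↔-sym 1↔⊤

Finite-¬ : ∀ {A} → ¬ A → Finite A
Finite-¬ ¬a = 0 , mk↔ₛ′ (⊥-elim ∘ ¬a) (λ ()) (λ ()) (⊥-elim ∘ ¬a)

Σ-Fin0-Finite : ∀ {P : Fin 0 → Set} → Finite (Σ (Fin 0) P)
Σ-Fin0-Finite = Finite-¬ λ ()

Σ-Fin-suc↔ : ∀ {n} {P : Fin (suc n) → Set} → Σ (Fin (suc n)) P ↔ (P zero ⊎ Σ (Fin n) (P ∘ suc))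
Σ-Fin-suc↔ = mk↔ₛ′ (λ { (zero , p) → inj₁ p ; (suc j , p) → inj₂ (j , p) })
                   (λ { (inj₁ p) → zero , p ; (inj₂ (j , p)) → suc j , p })
                   (λ { (inj₁ p) → refl ; (inj₂ _) → refl })
                   (λ { (zero , _) → refl ; (suc _ , _) → refl })

module _ (S : Setup) where
  open Setup S
  open Inverse code using ()
    renaming (to to encode; from to decode; strictlyInverseˡ to encode-decode; strictlyInverseʳ to decode-encode)
  open Inverse codeₓ using () renaming (to to encodeₓ; strictlyInverseʳ to deref-encodeₓ)
  private
    X = 𝔸 ⊎ 𝔹

  _↠h_ : Ext X → Ext X → Set
  _↠h_ = Star (_→h_ S)

  _↠h[_]_ : Ext X → Mach 𝔸 → Ext X → Set
  C ↠h[ M ] C' = Star (λ Y Z → _→h[_]_ S Y M Z) C C'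

  deref-inj₁ : ∀ a → deref S (inj₁ a) ≡ ext (embed (decode a))
  deref-inj₁ a = begin
    deref S (inj₁ a)                              ≡⟨ cong (deref S ∘ inj₁) (sym (encode-decode a)) ⟩
    deref S (inj₁ (encode (decode a)))            ≡⟨ cong (deref S) (sym (codeₓ-ext (decode a))) ⟩
    deref S (encodeₓ (ext (embed (decode a))))    ≡⟨ deref-encodeₓ _ ⟩
    ext (embed (decode a))                        ∎
    where open ≡-Reasoning

  deref-inj₁-appendE : ∀ a T →
    appendE (deref S (inj₁ a)) (List.map inj₁ T) ≡ ext (embed (appendM (decode a) T))
  deref-inj₁-appendE a T = trans (cong (λ C → appendE C (List.map inj₁ T)) (deref-inj₁ a))
                                 (cong ext (sym (embed-appendM (decode a) T)))

  inj₁-·-inj₁ : ∀ a b → _·_ S (inj₁ a) (inj₁ b) ≡ inj₁ (encode (appendM (decode a) (b ∷ [])))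
  inj₁-·-inj₁ a b = trans (cong encodeₓ (deref-inj₁-appendE a (b ∷ []))) (codeₓ-ext _)

  load-to : ∀ {r R i P a T v} {m : Mach X} → proj₁ m ≡ mk r (setReg R i (just a)) P T →
            _→h_ S (ext (mk r R (load i P) (a ∷ T) , v)) (ext m)
  load-to {m = _ , _} refl = load

  app-to : ∀ {r R i j k Q T v a b} {m : Mach X} → getReg R i ≡ just a → getReg R j ≡ just b →
           proj₁ m ≡ mk r (setReg R k (just (_·_ S a b))) (aprog Q) T →
           _→h_ S (ext (mk r R (aprog (app i j k Q)) T , v)) (ext m)
  app-to {m = _ , _} ga gb refl = app ga gb

  →h-deterministic : ∀ {C Y Z} → _→h_ S C Y → _→h_ S C Z → Y ≡ Z
  →h-deterministic load load = cong ext (Mach-≡ refl)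
  →h-deterministic (app ga gb) (app ga' gb') =
    cong ext (Mach-≡ (cong₂ (λ a b → mk _ (setReg _ _ (just (_·_ S a b))) _ _)
                            (just-injective (trans (sym ga) ga'))
                            (just-injective (trans (sym gb) gb'))))
  →h-deterministic (call ga) (call ga') =
    cong (λ a → appendE (deref S a) _) (just-injective (trans (sym ga) ga'))

  getReg-embed : ∀ {r} (R : Vec (Maybe 𝔸) r) i {a} → getReg R i ≡ just a →
                 getReg (Vec.map (Maybe.map (inj₁ {B = 𝔹})) R) i ≡ just (inj₁ a)
  getReg-embed R i ga = trans (getReg-map inj₁ R i) (cong (Maybe.map inj₁) ga)

  TapePath : List X → Set
  TapePath T = Σ (Fin (length T)) λ j → Path S (deref S (List.lookup T j))

  RegPath : ∀ {r} → Vec (Maybe X) r → Set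
  RegPath {r} R = Σ (Fin r) λ i → PathR S (Vec.lookup R i)

  Path-hole↔ : ∀ {T} → Path S (hole T) ↔ (⊤ ⊎ TapePath T)
  Path-hole↔ = mk↔ₛ′ (λ { here → inj₁ tt ; (tape-h j p) → inj₂ (j , p) })
                     (λ { (inj₁ _) → here ; (inj₂ (j , p)) → tape-h j p })
                     (λ { (inj₁ _) → refl ; (inj₂ _) → refl })
                     (λ { here → refl ; (tape-h _ _) → refl })

  Path-ext↔ : ∀ {r R P T v} → Path S (ext (mk r R P T , v)) ↔ (TapePath T ⊎ RegPath R)
  Path-ext↔ = mk↔ₛ′ (λ { (tape-m j p) → inj₁ (j , p) ; (reg-m i q) → inj₂ (i , q) })
                    (λ { (inj₁ (j , p)) → tape-m j p ; (inj₂ (i , q)) → reg-m i q })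
                    (λ { (inj₁ _) → refl ; (inj₂ _) → refl })
                    (λ { (tape-m _ _) → refl ; (reg-m _ _) → refl })

  PathR-just↔ : ∀ {a} → PathR S (just a) ↔ Path S (deref S a)
  PathR-just↔ = mk↔ₛ′ (λ { (at p) → p }) at (λ _ → refl) (λ { (at _) → refl })

  ¬PathR-nothing : ¬ PathR S nothing
  ¬PathR-nothing ()

  lookup-map-inj₁ : ∀ (T : List 𝔸) j → ∃ λ a → List.lookup (List.map (inj₁ {B = 𝔹}) T) j ≡ inj₁ a
  lookup-map-inj₁ (a ∷ T) zero    = a , refl
  lookup-map-inj₁ (a ∷ T) (suc j) = lookup-map-inj₁ T j

  -- Stated for any C equal to an embedding so that the recursion stays structural.
  ¬Path-embedded : ∀ {C m} → Path S C → C ≡ ext (embed m) → ⊥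
  ¬PathR-embedded : ∀ {x y} → PathR S x → x ≡ Maybe.map inj₁ y → ⊥
  ¬Path-embedded here ()
  ¬Path-embedded (tape-h _ _) ()
  ¬Path-embedded {m = mk _ _ _ T , _} (tape-m j p) refl with lookup-map-inj₁ T j
  ... | a , e = ¬Path-embedded p (trans (cong (deref S) e) (deref-inj₁ a))
  ¬Path-embedded {m = mk _ R _ _ , _} (reg-m i q) refl =
    ¬PathR-embedded {y = Vec.lookup R i} q (lookup-map i (Maybe.map inj₁) R)
  ¬PathR-embedded {y = just a}  (at p) refl = ¬Path-embedded p (deref-inj₁ a)
  ¬PathR-embedded {y = nothing} (at _) ()

  module _ (M : Mach 𝔸) where

    SubstR-embed : ∀ {r} (R : Vec (Maybe 𝔸) r) → SubstR S M (Vec.map (Maybe.map inj₁) R) R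
    SubstR-embed []            = []
    SubstR-embed (nothing ∷ R) = ∅∷ SubstR-embed R
    SubstR-embed (just a ∷ R)  = inA ∷ SubstR-embed R

    SubstT-embed : ∀ (T : List 𝔸) → SubstT S M (List.map inj₁ T) T
    SubstT-embed []      = []
    SubstT-embed (a ∷ T) = inA ∷ SubstT-embed T

    SubstE-embed : ∀ (m : Mach 𝔸) → SubstE S M (ext (embed m)) m
    SubstE-embed (mk r R P T , v) = mach (SubstR-embed R) (SubstT-embed T)

    SubstT-++ : ∀ {T₁ T₁' T₂ T₂'} → SubstT S M T₁ T₁' → SubstT S M T₂ T₂' →
                SubstT S M (T₁ ++ T₂) (T₁' ++ T₂')
    SubstT-++ []       s = s
    SubstT-++ (a ∷ t)  s = a ∷ SubstT-++ t s

    SubstE-appendE : ∀ {C K T T'} → SubstE S M C K → SubstT S M T T' →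
                     SubstE S M (appendE C T) (appendM K T')
    SubstE-appendE {T' = T'} (hole {T' = T₀'} t) s =
      subst (SubstE S M _) (sym (appendM-++ M T₀' T')) (hole (SubstT-++ t s))
    SubstE-appendE (mach r t) s = mach r (SubstT-++ t s)

    SubstE-functional : ∀ {C K K'} → SubstE S M C K → SubstE S M C K' → K ≡ K'
    SubstA-functional : ∀ {a a' a''} → SubstA S M a a' → SubstA S M a a'' → a' ≡ a''
    SubstT-functional : ∀ {T T' T''} → SubstT S M T T' → SubstT S M T T'' → T' ≡ T''
    SubstR-functional : ∀ {r} {R : Vec (Maybe X) r} {R' R''} →
                        SubstR S M R R' → SubstR S M R R'' → R' ≡ R''
    SubstE-functional (hole t) (hole t') = cong (appendM M) (SubstT-functional t t')
    SubstE-functional (mach r t) (mach r' t') =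
      Mach-≡ (cong₂ (λ R T → mk _ R _ T) (SubstR-functional r r') (SubstT-functional t t'))
    SubstA-functional inA inA = refl
    SubstA-functional (inB s) (inB s') = cong encode (SubstE-functional s s')
    SubstT-functional [] [] = refl
    SubstT-functional (a ∷ t) (a' ∷ t') = cong₂ _∷_ (SubstA-functional a a') (SubstT-functional t t')
    SubstR-functional [] [] = refl
    SubstR-functional (∅∷ r) (∅∷ r') = cong (nothing ∷_) (SubstR-functional r r')
    SubstR-functional (a ∷ r) (a' ∷ r') =
      cong₂ (λ x R → just x ∷ R) (SubstA-functional a a') (SubstR-functional r r')

    SubstA-deref : ∀ {a a'} → SubstA S M a a' → SubstE S M (deref S a) (decode a')
    SubstA-deref (inA {a}) =
      subst (λ C → SubstE S M C (decode a)) (sym (deref-inj₁ a)) (SubstE-embed (decode a))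
    SubstA-deref (inB {N = N} s) = subst (SubstE S M _) (sym (decode-encode N)) s

    -- An address of 𝔸 encodes an embedded machine, which is its own filling.
    SubstA-from-deref : ∀ x {K} → SubstE S M (deref S x) K → SubstA S M x (encode K)
    SubstA-from-deref (inj₂ b) s = inB s
    SubstA-from-deref (inj₁ a) {K} s =
      subst (SubstA S M (inj₁ a)) (trans (sym (encode-decode a)) (cong encode decode-a≡K)) inA
      where
        decode-a≡K : decode a ≡ K
        decode-a≡K = SubstE-functional (SubstE-embed (decode a)) (subst (λ C → SubstE S M C K) (deref-inj₁ a) s)

    SubstA-encodeₓ : ∀ {C K} → SubstE S M C K → SubstA S M (encodeₓ C) (encode K)
    SubstA-encodeₓ {C} {K} s =
      SubstA-from-deref (encodeₓ C) (subst (λ C → SubstE S M C K) (sym (deref-encodeₓ C)) s)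

    SubstA-· : ∀ {a a' b b'} → SubstA S M a a' → SubstA S M b b' →
               SubstA S M (_·_ S a b) (encode (appendM (decode a') (b' ∷ [])))
    SubstA-· sa sb = SubstA-encodeₓ (SubstE-appendE (SubstA-deref sa) (sb ∷ []))

    SubstR-setReg : ∀ {r} {R : Vec (Maybe X) r} {R' a a'} i → SubstR S M R R' → SubstA S M a a' →
                    SubstR S M (setReg R i (just a)) (setReg R' i (just a'))
    SubstR-setReg i       []      sa = []
    SubstR-setReg zero    (∅∷ s)  sa = sa ∷ s
    SubstR-setReg zero    (x ∷ s) sa = sa ∷ s
    SubstR-setReg (suc i) (∅∷ s)  sa = ∅∷ SubstR-setReg i s sa
    SubstR-setReg (suc i) (x ∷ s) sa = x ∷ SubstR-setReg i s sa

    getReg-SubstR : ∀ {r} {R : Vec (Maybe X) r} {R' a} i → SubstR S M R R' → getReg R i ≡ just a →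
                    Σ 𝔸 λ a' → getReg R' i ≡ just a' × SubstA S M a a'
    getReg-SubstR i       []      ()
    getReg-SubstR zero    (∅∷ s)  ()
    getReg-SubstR zero    (x ∷ s) refl = _ , refl , x
    getReg-SubstR (suc i) (∅∷ s)  e = getReg-SubstR i s e
    getReg-SubstR (suc i) (x ∷ s) e = getReg-SubstR i s e

    getReg-SubstR-embed : ∀ {r} {R : Vec (Maybe X) r} {R' x} i → SubstR S M R R' →
                          getReg (Vec.map (Maybe.map (inj₁ {B = 𝔹})) R') i ≡ just x →
                          ∃ λ a → getReg R i ≡ just a
    getReg-SubstR-embed i       []      ()
    getReg-SubstR-embed zero    (∅∷ s)  ()
    getReg-SubstR-embed zero    (x ∷ s) _ = _ , refl
    getReg-SubstR-embed (suc i) (∅∷ s)  e = getReg-SubstR-embed i s e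
    getReg-SubstR-embed (suc i) (x ∷ s) e = getReg-SubstR-embed i s e

    SubstE-OccFinite : ∀ {C K} → SubstE S M C K → OccFinite S C
    SubstA-deref-Finite : ∀ {a a'} → SubstA S M a a' → Finite (Path S (deref S a))
    SubstT-TapePath-Finite : ∀ {T T'} → SubstT S M T T' → Finite (TapePath T)
    SubstR-RegPath-Finite : ∀ {r} {R : Vec (Maybe X) r} {R'} → SubstR S M R R' → Finite (RegPath R)
    SubstE-OccFinite (hole t) = Finite-↔ Path-hole↔ (Finite-⊎ Finite-⊤ (SubstT-TapePath-Finite t))
    SubstE-OccFinite (mach r t) =
      Finite-↔ Path-ext↔ (Finite-⊎ (SubstT-TapePath-Finite t) (SubstR-RegPath-Finite r))
    SubstA-deref-Finite (inA {a}) = Finite-¬ (λ p → ¬Path-embedded p (deref-inj₁ a))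
    SubstA-deref-Finite (inB s) = SubstE-OccFinite s
    SubstT-TapePath-Finite [] = Σ-Fin0-Finite
    SubstT-TapePath-Finite (a ∷ t) =
      Finite-↔ Σ-Fin-suc↔ (Finite-⊎ (SubstA-deref-Finite a) (SubstT-TapePath-Finite t))
    SubstR-RegPath-Finite [] = Σ-Fin0-Finite
    SubstR-RegPath-Finite (∅∷ r) =
      Finite-↔ Σ-Fin-suc↔ (Finite-⊎ (Finite-¬ ¬PathR-nothing) (SubstR-RegPath-Finite r))
    SubstR-RegPath-Finite (a ∷ r) =
      Finite-↔ Σ-Fin-suc↔ (Finite-⊎ (Finite-↔ PathR-just↔ (SubstA-deref-Finite a)) (SubstR-RegPath-Finite r))

    simulate-→h : ∀ {C C₁ K} → SubstE S M C K → _→h_ S C C₁ →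
                  Σ (Mach 𝔸) λ K₁ → SubstE S M C₁ K₁ × _→h_ S (ext (embed K)) (ext (embed K₁))
    simulate-→h (hole _) ()
    simulate-→h (mach {R' = R'} {v' = w} sr (_∷_ {a' = a'} {T' = T'} sa st)) (load {i = i} {P}) =
      (mk _ (setReg R' i (just a')) P T' , load-reduct-valid R' i P a' w) ,
      mach (SubstR-setReg i sr sa) st ,
      load-to (cong (λ R → mk _ R _ _) (sym (setReg-map inj₁ R' i (just a'))))
    simulate-→h (mach {R' = R'} {T' = T'} {v' = w} sr st) (app {i = i} {j} {k} {Q} ga gb)
      with getReg-SubstR i sr ga | getReg-SubstR j sr gb
    ... | a' , ga' , sa | b' , gb' , sb =
      (mk _ (setReg R' k (just c)) _ T' , app-reduct-valid R' i j k Q c w) ,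
      mach (SubstR-setReg k sr (SubstA-· sa sb)) st ,
      app-to (getReg-embed R' i ga') (getReg-embed R' j gb') (cong (λ R → mk _ R _ _) filled-regs)
      where
        c = encode (appendM (decode a') (b' ∷ []))
        filled-regs : Vec.map (Maybe.map inj₁) (setReg R' k (just c))
                      ≡ setReg (Vec.map (Maybe.map inj₁) R') k (just (_·_ S (inj₁ a') (inj₁ b')))
        filled-regs = trans (sym (setReg-map inj₁ R' k (just c)))
                            (cong (λ x → setReg _ k (just x)) (sym (inj₁-·-inj₁ a' b')))
    simulate-→h (mach {R' = R'} {T' = T'} sr st) (call {i = i} ga) with getReg-SubstR i sr ga
    ... | a' , ga' , sa =
      appendM (decode a') T' , SubstE-appendE (SubstA-deref sa) st ,
      subst (_→h_ S _) (deref-inj₁-appendE a' T') (call (getReg-embed R' i ga'))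

    simulate-→h[] : ∀ {C C₁ K} → SubstE S M C K → _→h[_]_ S C M C₁ →
                    Σ (Mach 𝔸) λ K₁ → SubstE S M C₁ K₁ × ext (embed K) ↠h ext (embed K₁)
    simulate-→h[] (hole t) fill = _ , SubstE-appendE (SubstE-embed M) t , ε
    simulate-→h[] s (head x) with simulate-→h s x
    ... | K₁ , s₁ , x₁ = K₁ , s₁ , x₁ ◅ ε

    simulate-↠h[] : ∀ {C C' K} → SubstE S M C K → C ↠h[ M ] C' →
                    Σ (Mach 𝔸) λ K' → SubstE S M C' K' × ext (embed K) ↠h ext (embed K')
    simulate-↠h[] s ε = _ , s , ε
    simulate-↠h[] s (x ◅ xs) with simulate-→h[] s x
    ... | K₁ , s₁ , st₁ with simulate-↠h[] s₁ xs
    ... | K' , s' , st' = K' , s' , st₁ ◅◅ st'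

    →h-progress : ∀ {m K Y} → SubstE S M (ext m) K → _→h_ S (ext (embed K)) Y → ∃ (_→h_ S (ext m))
    →h-progress (mach {R = R} {v = v} sr (_∷_ {a} _ _)) (load {i = i} {P}) =
      _ , load {v' = load-reduct-valid R i P a v}
    →h-progress (mach {R = R} {v = v} sr _) (app {i = i} {j} {k} {Q} gx gy)
      with getReg-SubstR-embed i sr gx | getReg-SubstR-embed j sr gy
    ... | a , ga | b , gb = _ , app {v' = app-reduct-valid R i j k Q (_·_ S a b) v} ga gb
    →h-progress (mach sr _) (call {i = i} gx) with getReg-SubstR-embed i sr gx
    ... | _ , ga = _ , call ga

    ReductFilling : Ext X → Ext X → Set
    ReductFilling C Y = Σ (Ext X) λ C' → Σ (Mach 𝔸) λ K' →
                        C ↠h[ M ] C' × SubstE S M C' K' × Y ≡ ext (embed K')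

    lift-→h-ext : ∀ {m K Y} → SubstE S M (ext m) K → _→h_ S (ext (embed K)) Y → ReductFilling (ext m) Y
    lift-→h-ext s x with →h-progress s x
    ... | C₁ , y with simulate-→h s y
    ... | K₁ , s₁ , x₁ = C₁ , K₁ , head y ◅ ε , s₁ , →h-deterministic x x₁

    lift-→h : ∀ {C K Y} → SubstE S M C K → _→h_ S (ext (embed K)) Y → ReductFilling C Y
    lift-→h (hole t) x with lift-→h-ext (SubstE-appendE (SubstE-embed M) t) x
    ... | C₁ , K₁ , st , s₁ , e = C₁ , K₁ , fill ◅ st , s₁ , e
    lift-→h s@(mach _ _) x = lift-→h-ext s x

    lift-↠h : ∀ {C K Z} → SubstE S M C K → ext (embed K) ↠h Z → ReductFilling C Z
    lift-↠h s ε = _ , _ , ε , s , refl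
    lift-↠h s (x ◅ xs) with lift-→h s x
    ... | C₁ , K₁ , st₁ , s₁ , refl with lift-↠h s₁ xs
    ... | C' , K' , st' , s' , e' = C' , K' , st₁ ◅◅ st' , s' , e'

lemma5p6 : (S : Setup) (C : Ext (𝕏 S)) → OccFinite S C →
           (M N K : Mach (Setup.𝔸 S)) → SubstE S M C K →
           (Star (_→h_ S) (ext (embed K)) (ext (embed N))
             ⇔ Σ (Ext (𝕏 S)) (λ C' → Star (λ X Y → _→h[_]_ S X M Y) C C'
                                       × OccFinite S C' × SubstE S M C' N))
lemma5p6 S C _ M N K s = mk⇔ lift simulate
  where
    lift : _↠h_ S (ext (embed K)) (ext (embed N)) →
           Σ (Ext (𝕏 S)) λ C' → _↠h[_]_ S C M C' × OccFinite S C' × SubstE S M C' N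
    lift st with lift-↠h S M s st
    ... | C' , K' , C↠C' , s' , N≡K' =
      C' , C↠C' , SubstE-OccFinite S M s' , subst (SubstE S M C') (embed-injective (sym N≡K')) s'

    simulate : (Σ (Ext (𝕏 S)) λ C' → _↠h[_]_ S C M C' × OccFinite S C' × SubstE S M C' N) →
               _↠h_ S (ext (embed K)) (ext (embed N))
    simulate (C' , C↠C' , _ , s'') with simulate-↠h[] S M s C↠C'
    ... | K' , s' , st = subst (λ K' → _↠h_ S (ext (embed K)) (ext (embed K'))) (SubstE-functional S M s' s'') st
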